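{- Let $d$ be a positive integer and let $\mathcal{G}$ be a class of graphs closed under taking induced minors. Then for every graph $G \in \mathcal{G}$, we have $\chi_d^=(G) \leq \max_{H \in \mathcal{G}} \chi(H)$ if and only if $\mathcal{R}_d(G)$ is non-empty.
   Context: All graphs are finite, simple and undirected. An exact $(k,d)$-coloring of $G=(V,E)$ is a map $c: V\to\{1,\dots,k\}$ such that every vertex has exactly $d$ neighbors of its own color; $\chi_d^=(G)$ is the least $k$ for which one exists ($\infty$ if none). $\chi(H)$ denotes the (proper) chromatic number. $\mathcal{R}_d(G)$ is the set of all partitions of $V$ into sets each inducing a $d$-regular subgraph of $G$. A graph $H$ is an induced minor of $G$ if $H$ can be obtained from $G$ by deleting vertices and contracting edges; a class is closed under induced minors if every induced minor of a member is a member. -}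

module Defs where

open import Data.Nat using (ℕ; zero; suc; _≤_)
open import Data.Bool using (Bool; true; false; _∧_)
open import Data.Fin using (Fin; punchIn)
open import Data.Fin.Subset using (Subset; _∈_; Nonempty)
open import Data.List using (List; length; filterᵇ)
open import Data.List.Base using (allFin)
open import Data.Product using (Σ; ∃; _×_; _,_)
open import Data.Sum using (_⊎_)
open import Relation.Nullary using (¬_; ⌊_⌋)
open import Relation.Binary.PropositionalEquality using (_≡_; _≢_)
open import Function.Bundles using (_↔_; _⇔_; Inverse)
import Data.Fin as F
open import Data.Fin.Subset.Properties using (_∈?_)

record Graph (n : ℕ) : Set where
  field
    adj   : Fin n → Fin n → Bool
    sym   : ∀ u v → adj u v ≡ adj v u
    irref : ∀ v → adj v v ≡ false
open Graph public

count : ∀ {n} → (Fin n → Bool) → ℕ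
count {n} p = length (filterᵇ p (allFin n))

sameColourDeg : ∀ {n k} → Graph n → (Fin n → Fin k) → Fin n → ℕ
sameColourDeg G c v = count (λ u → adj G v u ∧ ⌊ c u F.≟ c v ⌋)

ExactColouring : ∀ {n} → Graph n → (k d : ℕ) → Set
ExactColouring {n} G k d = Σ (Fin n → Fin k) λ c → ∀ v → sameColourDeg G c v ≡ d

IsExactChromaticNumber : ∀ {n} → Graph n → (d k : ℕ) → Set
IsExactChromaticNumber G d k =
  ExactColouring G k d × (∀ m → ExactColouring G m d → k ≤ m)

ProperColouring : ∀ {n} → Graph n → ℕ → Set
ProperColouring {n} G k =
  Σ (Fin n → Fin k) λ c → ∀ u v → adj G u v ≡ true → c u ≢ c v

IsChromaticNumber : ∀ {n} → Graph n → ℕ → Set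
IsChromaticNumber G k = ProperColouring G k × (∀ m → ProperColouring G m → k ≤ m)

degIn : ∀ {n} → Graph n → Subset n → Fin n → ℕ
degIn G S v = count (λ u → adj G v u ∧ ⌊ u ∈? S ⌋)

record RegularPartition {n} (G : Graph n) (d : ℕ) : Set where
  field
    k        : ℕ
    part     : Fin k → Subset n
    nonempty : ∀ i → Nonempty (part i)
    covers   : ∀ v → ∃ λ i → v ∈ part i
    disjoint : ∀ i j v → v ∈ part i → v ∈ part j → i ≡ j
    regular  : ∀ i v → v ∈ part i → degIn G (part i) v ≡ d

Rnonempty : ∀ {n} → Graph n → ℕ → Set
Rnonempty G d = RegularPartition G d

Iso : ∀ {m n} → Graph m → Graph n → Set
Iso {m} {n} G H = Σ (Fin m ↔ Fin n) λ f →
  ∀ u v → adj H (Inverse.to f u) (Inverse.to f v) ≡ adj G u v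

DeleteStep : ∀ {n} → Graph (suc n) → Graph n → Set
DeleteStep {n} G H = Σ (Fin (suc n)) λ v →
  ∀ i j → adj H i j ≡ adj G (punchIn v i) (punchIn v j)

-- H is G with the edge uv contracted: v is merged into u
ContractStep : ∀ {n} → Graph (suc n) → Graph n → Set
ContractStep {n} G H = Σ (Fin (suc n)) λ u → Σ (Fin (suc n)) λ v →
  u ≢ v × adj G u v ≡ true ×
  (∀ i j → (adj H i j ≡ true) ⇔
     (i ≢ j × (adj G (punchIn v i) (punchIn v j) ≡ true
              ⊎ (punchIn v i ≡ u × adj G v (punchIn v j) ≡ true)
              ⊎ (punchIn v j ≡ u × adj G (punchIn v i) v ≡ true))))

data _≼_ : ∀ {m n} → Graph m → Graph n → Set where
  iso      : ∀ {m n} {H : Graph m} {G : Graph n} → Iso G H → H ≼ G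
  delete   : ∀ {m n} {H : Graph m} {G : Graph (suc n)} {G' : Graph n} →
             DeleteStep G G' → H ≼ G' → H ≼ G
  contract : ∀ {m n} {H : Graph m} {G : Graph (suc n)} {G' : Graph n} →
             ContractStep G G' → H ≼ G' → H ≼ G

GraphClass : Set₁
GraphClass = ∀ {n} → Graph n → Set

ClosedUnderInducedMinors : GraphClass → Set
ClosedUnderInducedMinors 𝒢 =
  ∀ {m n} (G : Graph n) (H : Graph m) → H ≼ G → 𝒢 G → 𝒢 H

-- χ_d^=(G) ≤ max_{H ∈ 𝒢} χ(H): χ_d^=(G) is finite, and bounded by χ(H) for some H ∈ 𝒢
ExactChromaticBoundedByClass : GraphClass → ∀ {n} → Graph n → ℕ → Set
ExactChromaticBoundedByClass 𝒢 G d =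
  ∃ λ k → IsExactChromaticNumber G d k ×
    Σ ℕ λ m → Σ (Graph m) λ H → 𝒢 H ×
      ∃ λ χH → IsChromaticNumber H χH × k ≤ χH

-- An optimal exact colouring uses every colour (an unused one could be dropped), so its colour
-- classes partition V into sets inducing d-regular subgraphs. Conversely, given such a
-- partition, contracting every edge inside a part gives an induced minor H of G in which
-- edges between different parts survive. Pulling a proper χ(H)-colouring of H back to G
-- colours adjacent vertices alike exactly when they lie in the same part, so it is an exact
-- (χ(H), d)-colouring, and χ_d^=(G) ≤ χ(H).

module Submission where

open import Defs
open import Data.Nat using (ℕ; _<_)
open import Function.Bundles using (_⇔_)

open import Data.Nat using (zero; suc; _≤_)
import Data.Nat as ℕ
open import Data.Nat.Properties using (≮⇒≥; ≤-refl; ≤-trans; <⇒≤; anyUpTo?; n≮n)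
open import Data.Nat.Induction using (<-rec)
open import Data.Bool using (Bool; true; false; _∧_; T; T?)
import Data.Bool as Bool
open import Data.Fin as Fin using (Fin; punchIn; punchOut; finToFun; funToFin)
open import Data.Fin.Properties using (any?; all?; finToFun-funToFin; punchOut-injective; punchOut-cong; punchIn-punchOut)
open import Data.Fin.Subset using (Subset; _∈_)
open import Data.Fin.Subset.Properties using (_∈?_)
open import Data.Vec using (tabulate)
open import Data.Vec.Properties using (lookup∘tabulate; []=⇒lookup; lookup⇒[]=)
open import Data.List using (length)
open import Data.List.Base using (allFin)
open import Data.List.Properties using (filter-≐)
open import Data.Product using (∃; _×_; _,_; proj₁; proj₂)
open import Data.Sum using (_⊎_; inj₁; inj₂)
open import Level using (0ℓ)
open import Relation.Unary using (Pred; Decidable)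
open import Relation.Nullary using (Dec; yes; no; contradiction)
open import Relation.Nullary.Decidable using (decidable-stable; isYes; isYes≗does; does-⇔; map′; _×-dec_; _⊎-dec_; _→-dec_; ¬?)
open import Relation.Binary.PropositionalEquality using (_≡_; _≢_; refl; trans; cong; subst; subst₂; _≗_)
import Relation.Binary.PropositionalEquality as ≡
open import Function using (_∘_)
open import Function.Bundles using (mk⇔; Equivalence)
open import Function.Construct.Identity using (↔-id)
open import Function.Construct.Symmetry using (⇔-sym)

open Equivalence using (to; from)

isYes≡true⇔ : ∀ {A : Set} (a? : Dec A) → isYes a? ≡ true ⇔ A
isYes≡true⇔ (yes a) = mk⇔ (λ _ → a) (λ _ → refl)
isYes≡true⇔ (no ¬a) = mk⇔ (λ ()) (λ a → contradiction a ¬a)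

isYes-⇔ : ∀ {A B : Set} → A ⇔ B → (a? : Dec A) (b? : Dec B) → isYes a? ≡ isYes b?
isYes-⇔ A⇔B a? b? = trans (isYes≗does a?) (trans (does-⇔ A⇔B a? b?) (≡.sym (isYes≗does b?)))

Least : Pred ℕ 0ℓ → ℕ → Set
Least P k = P k × (∀ m → P m → k ≤ m)

least : ∀ {P : Pred ℕ 0ℓ} → Decidable P → ∀ {k} → P k → ∃ λ m → Least P m × m ≤ k
least {P} P? {k} = <-rec (λ k → P k → ∃ λ m → Least P m × m ≤ k) search k
  where
  search : ∀ k → (∀ {j} → j < k → P j → ∃ λ m → Least P m × m ≤ j) →
           P k → ∃ λ m → Least P m × m ≤ k
  search k below Pk with anyUpTo? P? k
  ... | yes (j , j<k , Pj) =
    let m , leastM , m≤j = below j<k Pj in m , leastM , ≤-trans m≤j (<⇒≤ j<k)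
  ... | no none = k , (Pk , λ m Pm → ≮⇒≥ λ m<k → none (m , m<k , Pm)) , ≤-refl

-- Functions Fin n → Fin m are enumerated by Fin (m ^ n).
∃-function? : ∀ {n m} {P : Pred (Fin n → Fin m) 0ℓ} →
  (∀ {f g} → f ≗ g → P f → P g) → Decidable P → Dec (∃ P)
∃-function? resp P? = map′ (λ (i , Pi) → finToFun i , Pi)
  (λ (f , Pf) → funToFin f , resp (≡.sym ∘ finToFun-funToFin f) Pf)
  (any? (P? ∘ finToFun))

count-cong : ∀ {n} {p q : Fin n → Bool} → p ≗ q → count p ≡ count q
count-cong {n} {p} {q} p≗q = cong length (filter-≐ (T? ∘ p) (T? ∘ q)
  ((λ {x} → subst T (p≗q x)) , (λ {x} → subst T (≡.sym (p≗q x)))) (allFin n))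

adj⇒≢ : ∀ {n} (G : Graph n) {u v} → adj G u v ≡ true → u ≢ v
adj⇒≢ G {u} uv refl = contradiction (trans (≡.sym uv) (irref G u)) λ ()

neighbourCount : ∀ {n} → Graph n → Fin n → {P : Pred (Fin n) 0ℓ} → Decidable P → ℕ
neighbourCount G v P? = count (λ u → adj G v u ∧ isYes (P? u))

neighbourCount-cong : ∀ {n} (G : Graph n) v {P Q : Pred (Fin n) 0ℓ} (P? : Decidable P) (Q? : Decidable Q) →
  (∀ u → adj G v u ≡ true → P u ⇔ Q u) → neighbourCount G v P? ≡ neighbourCount G v Q?
neighbourCount-cong G v P? Q? P⇔Q = count-cong same
  where
  same : ∀ u → adj G v u ∧ isYes (P? u) ≡ adj G v u ∧ isYes (Q? u)
  same u with adj G v u in vu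
  ... | false = refl
  ... | true  = isYes-⇔ (P⇔Q u vu) (P? u) (Q? u)

IsExactColouring : ∀ {n k} → Graph n → ℕ → (Fin n → Fin k) → Set
IsExactColouring {n} G d c = ∀ (v : Fin n) → sameColourDeg G c v ≡ d

SameColourOnEdges : ∀ {n k l} → Graph n → (Fin n → Fin k) → (Fin n → Fin l) → Set
SameColourOnEdges G c c′ = ∀ u v → adj G u v ≡ true → (c u ≡ c v) ⇔ (c′ u ≡ c′ v)

isExactColouring-transfer : ∀ {n k l d} (G : Graph n) {c : Fin n → Fin k} {c′ : Fin n → Fin l} →
  SameColourOnEdges G c c′ → IsExactColouring G d c → IsExactColouring G d c′
isExactColouring-transfer G {c} {c′} same exact v =
  trans (neighbourCount-cong G v (λ u → c′ u Fin.≟ c′ v) (λ u → c u Fin.≟ c v)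
          λ u vu → ⇔-sym (same u v (trans (sym G u v) vu)))
        (exact v)

≗⇒sameColourOnEdges : ∀ {n k} (G : Graph n) {c c′ : Fin n → Fin k} →
  c ≗ c′ → SameColourOnEdges G c c′
≗⇒sameColourOnEdges G c≗c′ u v _ = mk⇔
  (λ e → trans (≡.sym (c≗c′ u)) (trans e (c≗c′ v)))
  (λ e → trans (c≗c′ u) (trans e (≡.sym (c≗c′ v))))

exactColouring? : ∀ {n} (G : Graph n) k d → Dec (ExactColouring G k d)
exactColouring? G k d =
  ∃-function? (λ c≗c′ → isExactColouring-transfer G (≗⇒sameColourOnEdges G c≗c′))
              (λ c → all? λ v → sameColourDeg G c v ℕ.≟ d)

properColouring? : ∀ {n} (G : Graph n) k → Dec (ProperColouring G k)
properColouring? G k = ∃-function? resp λ c → all? λ u → all? λ v →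
  (adj G u v Bool.≟ true) →-dec ¬? (c u Fin.≟ c v)
  where
  resp : ∀ {c c′ : Fin _ → Fin k} → c ≗ c′ → (∀ u v → adj G u v ≡ true → c u ≢ c v) →
         ∀ u v → adj G u v ≡ true → c′ u ≢ c′ v
  resp c≗c′ proper u v uv = proper u v uv ∘ from (≗⇒sameColourOnEdges G c≗c′ u v uv)

exactChromaticNumber-≤ : ∀ {n} (G : Graph n) {k d} → ExactColouring G k d →
  ∃ λ k′ → IsExactChromaticNumber G d k′ × k′ ≤ k
exactChromaticNumber-≤ G {d = d} = least (λ k → exactColouring? G k d)

chromaticNumber : ∀ {n} (G : Graph n) → ∃ (IsChromaticNumber G)
chromaticNumber {n} G = let χ , isχ , _ = least (properColouring? G) identityProper in χ , isχ
  where
  identityProper : ProperColouring G n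
  identityProper = (λ v → v) , λ _ _ → adj⇒≢ G

colourClass : ∀ {n k} → (Fin n → Fin k) → Fin k → Subset n
colourClass c i = tabulate λ v → isYes (c v Fin.≟ i)

∈colourClass : ∀ {n k} (c : Fin n → Fin k) {i v} → v ∈ colourClass c i ⇔ c v ≡ i
∈colourClass c {i} {v} = mk⇔
  (λ v∈i → to (isYes≡true⇔ (c v Fin.≟ i))
                (trans (≡.sym (lookup∘tabulate _ v)) ([]=⇒lookup v∈i)))
  (λ cv≡i → lookup⇒[]= v _
                (trans (lookup∘tabulate _ v) (from (isYes≡true⇔ (c v Fin.≟ i)) cv≡i)))

module _ {n} (G : Graph n) (d : ℕ) where

  removeUnusedColour : ∀ {k} (c : Fin n → Fin (suc k)) (j : Fin (suc k)) → (∀ v → c v ≢ j) →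
    IsExactColouring G d c → ExactColouring G k d
  removeUnusedColour c j unused exact = c′ , isExactColouring-transfer G same exact
    where
    c′ : Fin n → Fin _
    c′ v = punchOut (unused v ∘ ≡.sym)
    same : SameColourOnEdges G c c′
    same u v _ = mk⇔ (punchOut-cong j) (punchOut-injective {i = j} _ _)

  optimalExactColouring-surjective : ∀ {k} (c : Fin n → Fin k) → IsExactColouring G d c →
    (∀ m → ExactColouring G m d → k ≤ m) → ∀ j → ∃ λ v → c v ≡ j
  optimalExactColouring-surjective {suc k} c exact minimal j with any? (λ v → c v Fin.≟ j)
  ... | yes used  = used
  ... | no unused = contradiction
    (minimal k (removeUnusedColour c j (λ v cv≡j → unused (v , cv≡j)) exact)) (n≮n k)

  colourClassPartition : ∀ {k} (c : Fin n → Fin k) → IsExactColouring G d c →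
    (∀ j → ∃ λ v → c v ≡ j) → RegularPartition G d
  colourClassPartition {k} c exact surjective = record
    { k        = k
    ; part     = colourClass c
    ; nonempty = λ i → let v , cv≡i = surjective i in v , from (∈colourClass c) cv≡i
    ; covers   = λ v → c v , from (∈colourClass c) refl
    ; disjoint = λ i j v v∈i v∈j → trans (≡.sym (to (∈colourClass c) v∈i)) (to (∈colourClass c) v∈j)
    ; regular  = λ i v v∈i →
        trans (neighbourCount-cong G v (_∈? colourClass c i) (λ u → c u Fin.≟ c v)
                 λ u _ → sameClass u v∈i)
              (exact v)
    }
    where
    sameClass : ∀ {i v} u → v ∈ colourClass c i → (u ∈ colourClass c i) ⇔ (c u ≡ c v)
    sameClass u v∈i = let cv≡i = to (∈colourClass c) v∈i in mk⇔
      (λ u∈i → trans (to (∈colourClass c) u∈i) (≡.sym cv≡i))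
      (λ cu≡cv → from (∈colourClass c) (trans cu≡cv cv≡i))

regularPartition⇒exactColouring : ∀ {n} {G : Graph n} {d} (R : RegularPartition G d) →
  ExactColouring G (RegularPartition.k R) d
regularPartition⇒exactColouring {G = G} R = partOf , λ v →
  trans (neighbourCount-cong G v (λ u → partOf u Fin.≟ partOf v) (_∈? part (partOf v))
          λ u _ → sameClass u v)
        (regular (partOf v) v (inPart v))
  where
  open RegularPartition R
  partOf : Fin _ → Fin k
  partOf v = proj₁ (covers v)
  inPart : ∀ v → v ∈ part (partOf v)
  inPart v = proj₂ (covers v)
  sameClass : ∀ u v → (partOf u ≡ partOf v) ⇔ (u ∈ part (partOf v))
  sameClass u v = mk⇔ (λ e → subst (λ i → u ∈ part i) e (inPart u)) (disjoint _ _ u (inPart u))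

-- Vertex i of the contracted graph is vertex punchIn v i of G; v is merged into u.
module EdgeContraction {n} (G : Graph (suc n)) (u v : Fin (suc n)) where

  Joined : Fin n → Fin n → Set
  Joined i j = adj G (punchIn v i) (punchIn v j) ≡ true
             ⊎ (punchIn v i ≡ u × adj G v (punchIn v j) ≡ true)
             ⊎ (punchIn v j ≡ u × adj G (punchIn v i) v ≡ true)

  ContractedAdj : Fin n → Fin n → Set
  ContractedAdj i j = i ≢ j × Joined i j

  contractedAdj? : ∀ i j → Dec (ContractedAdj i j)
  contractedAdj? i j = ¬? (i Fin.≟ j) ×-dec (adj≡true? (punchIn v i) (punchIn v j)
    ⊎-dec ((punchIn v i Fin.≟ u) ×-dec adj≡true? v (punchIn v j))
    ⊎-dec ((punchIn v j Fin.≟ u) ×-dec adj≡true? (punchIn v i) v))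
    where
    adj≡true? : ∀ a b → Dec (adj G a b ≡ true)
    adj≡true? a b = adj G a b Bool.≟ true

  contractedAdj-sym : ∀ {i j} → ContractedAdj i j → ContractedAdj j i
  contractedAdj-sym (i≢j , inj₁ ij) =
    i≢j ∘ ≡.sym , inj₁ (trans (sym G _ _) ij)
  contractedAdj-sym (i≢j , inj₂ (inj₁ (i≡u , vj))) =
    i≢j ∘ ≡.sym , inj₂ (inj₂ (i≡u , trans (sym G _ _) vj))
  contractedAdj-sym (i≢j , inj₂ (inj₂ (j≡u , iv))) =
    i≢j ∘ ≡.sym , inj₂ (inj₁ (j≡u , trans (sym G _ _) iv))

  contracted : Graph n
  contracted = record
    { adj   = λ i j → isYes (contractedAdj? i j)
    ; sym   = λ i j → isYes-⇔ (mk⇔ contractedAdj-sym contractedAdj-sym)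
                               (contractedAdj? i j) (contractedAdj? j i)
    ; irref = λ i → isYes-⇔ (mk⇔ (λ (i≢i , _) → i≢i refl) λ ()) (contractedAdj? i i) (no λ ())
    }

  contractStep : u ≢ v → adj G u v ≡ true → ContractStep G contracted
  contractStep u≢v uv = u , v , u≢v , uv , λ i j → isYes≡true⇔ (contractedAdj? i j)

  module Merge (v≢u : v ≢ u) where

    merge : Fin (suc n) → Fin n
    merge w with w Fin.≟ v
    ... | yes _  = punchOut v≢u
    ... | no w≢v = punchOut (w≢v ∘ ≡.sym)

    MergeImage : Fin (suc n) → Set
    MergeImage w = (w ≡ v × punchIn v (merge w) ≡ u) ⊎ (w ≢ v × punchIn v (merge w) ≡ w)

    punchIn-merge : ∀ w → MergeImage w
    punchIn-merge w with w Fin.≟ v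
    ... | yes w≡v = inj₁ (w≡v , punchIn-punchOut v≢u)
    ... | no w≢v  = inj₂ (w≢v , punchIn-punchOut _)

    merge-adj : ∀ w₁ w₂ → adj G w₁ w₂ ≡ true → merge w₁ ≢ merge w₂ →
      adj contracted (merge w₁) (merge w₂) ≡ true
    merge-adj w₁ w₂ w₁w₂ m₁≢m₂ = from (isYes≡true⇔ (contractedAdj? _ _))
      (m₁≢m₂ , joined (punchIn-merge w₁) (punchIn-merge w₂))
      where
      joined : MergeImage w₁ → MergeImage w₂ → Joined (merge w₁) (merge w₂)
      joined (inj₁ (refl , _))  (inj₁ (refl , _))  = contradiction refl m₁≢m₂
      joined (inj₁ (refl , e₁)) (inj₂ (_ , e₂))    =
        inj₂ (inj₁ (e₁ , subst (λ x → adj G v x ≡ true) (≡.sym e₂) w₁w₂))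
      joined (inj₂ (_ , e₁))    (inj₁ (refl , e₂)) =
        inj₂ (inj₂ (e₂ , subst (λ x → adj G x v ≡ true) (≡.sym e₁) w₁w₂))
      joined (inj₂ (_ , e₁))    (inj₂ (_ , e₂))    =
        inj₁ (subst₂ (λ x y → adj G x y ≡ true) (≡.sym e₁) (≡.sym e₂) w₁w₂)

record ClassContraction {n k} (G : Graph n) (p : Fin n → Fin k) : Set where
  field
    m          : ℕ
    H          : Graph m
    H≼G        : H ≼ G
    π          : Fin n → Fin m
    π-edge     : ∀ a b → adj G a b ≡ true → p a ≢ p b → adj H (π a) (π b) ≡ true
    π-collapse : ∀ a b → adj G a b ≡ true → p a ≡ p b → π a ≡ π b

identityContraction : ∀ {n k} (G : Graph n) (p : Fin n → Fin k) →
  (∀ a b → adj G a b ≡ true → p a ≢ p b) → ClassContraction G p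
identityContraction {n} G p noInternalEdge = record
  { m          = n
  ; H          = G
  ; H≼G        = iso (↔-id (Fin n) , λ _ _ → refl)
  ; π          = λ a → a
  ; π-edge     = λ _ _ ab _ → ab
  ; π-collapse = λ a b ab pa≡pb → contradiction pa≡pb (noInternalEdge a b ab)
  }

extendContraction : ∀ {n k} (G : Graph (suc n)) (p : Fin (suc n) → Fin k) {u v} →
  (uv : adj G u v ≡ true) → p u ≡ p v →
  ClassContraction (EdgeContraction.contracted G u v) (p ∘ punchIn v) → ClassContraction G p
extendContraction G p {u} {v} uv pu≡pv R = record
  { m          = m
  ; H          = H
  ; H≼G        = contract (contractStep (adj⇒≢ G uv) uv) H≼G
  ; π          = π ∘ merge
  ; π-edge     = λ a b ab pa≢pb →
      π-edge (merge a) (merge b) (merge-adj a b ab (pa≢pb ∘ sameClass)) (pa≢pb ∘ sameClass′)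
  ; π-collapse = collapse
  }
  where
  open EdgeContraction G u v
  open Merge (adj⇒≢ G uv ∘ ≡.sym)
  open ClassContraction R

  p-merge : ∀ w → p (punchIn v (merge w)) ≡ p w
  p-merge w with punchIn-merge w
  ... | inj₁ (refl , e) = trans (cong p e) pu≡pv
  ... | inj₂ (_ , e)    = cong p e

  sameClass′ : ∀ {a b} → p (punchIn v (merge a)) ≡ p (punchIn v (merge b)) → p a ≡ p b
  sameClass′ {a} {b} e = trans (≡.sym (p-merge a)) (trans e (p-merge b))

  sameClass : ∀ {a b} → merge a ≡ merge b → p a ≡ p b
  sameClass = sameClass′ ∘ cong (p ∘ punchIn v)

  collapse : ∀ a b → adj G a b ≡ true → p a ≡ p b → π (merge a) ≡ π (merge b)
  collapse a b ab pa≡pb with merge a Fin.≟ merge b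
  ... | yes ma≡mb = cong π ma≡mb
  ... | no ma≢mb  = π-collapse _ _ (merge-adj a b ab ma≢mb)
                      (trans (p-merge a) (trans pa≡pb (≡.sym (p-merge b))))

classContraction : ∀ {n k} (G : Graph n) (p : Fin n → Fin k) → ClassContraction G p
classContraction {zero} G p = identityContraction G p λ ()
classContraction {suc n} G p
  with any? (λ u → any? λ v → (adj G u v Bool.≟ true) ×-dec (p u Fin.≟ p v))
... | yes (u , v , uv , pu≡pv) = extendContraction G p uv pu≡pv
        (classContraction (EdgeContraction.contracted G u v) (p ∘ punchIn v))
... | no none = identityContraction G p λ a b ab pa≡pb → none (a , b , ab , pa≡pb)

properColouring∘contraction-exact : ∀ {n k d} {G : Graph n} {p : Fin n → Fin k} →
  IsExactColouring G d p → (C : ClassContraction G p) →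
  ∀ {χ} → ProperColouring (ClassContraction.H C) χ → ExactColouring G χ d
properColouring∘contraction-exact {G = G} {p} exact C (κ , proper) =
  κ ∘ π , isExactColouring-transfer G same exact
  where
  open ClassContraction C
  same : SameColourOnEdges G p (κ ∘ π)
  same u v uv = mk⇔
    (cong κ ∘ π-collapse u v uv)
    (λ κu≡κv → decidable-stable (p u Fin.≟ p v) λ pu≢pv → proper _ _ (π-edge u v uv pu≢pv) κu≡κv)

exactChromaticNumber≤contractionChromaticNumber : ∀ {n k d} {G : Graph n} {p : Fin n → Fin k} →
  IsExactColouring G d p → (C : ClassContraction G p) →
  ∃ λ χ → IsChromaticNumber (ClassContraction.H C) χ ×
    ∃ λ k′ → IsExactChromaticNumber G d k′ × k′ ≤ χ
exactChromaticNumber≤contractionChromaticNumber {G = G} exact C =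
  let χ , isχ = chromaticNumber (ClassContraction.H C)
      κ = proj₁ isχ
      k′ , optimal , k′≤χ = exactChromaticNumber-≤ G (properColouring∘contraction-exact exact C κ)
  in χ , isχ , k′ , optimal , k′≤χ

mainTheorem2 : (d : ℕ) → 0 < d → (𝒢 : GraphClass) → ClosedUnderInducedMinors 𝒢 →
    ∀ {n} (G : Graph n) → 𝒢 G →
      ExactChromaticBoundedByClass 𝒢 G d ⇔ Rnonempty G d
mainTheorem2 d _ 𝒢 closed G G∈𝒢 = mk⇔ forward backward
  where
  forward : ExactChromaticBoundedByClass 𝒢 G d → Rnonempty G d
  forward (_ , ((c , exact) , minimal) , _) =
    colourClassPartition G d c exact (optimalExactColouring-surjective G d c exact minimal)

  backward : Rnonempty G d → ExactChromaticBoundedByClass 𝒢 G d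
  backward R =
    let p , exact = regularPartition⇒exactColouring R
        C = classContraction G p
        open ClassContraction C using (H; H≼G)
        χ , isχ , k , optimal , k≤χ = exactChromaticNumber≤contractionChromaticNumber exact C
    in k , optimal , _ , H , closed G H H≼G G∈𝒢 , χ , isχ , k≤χ
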